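{- Let $0\le k\le n$ and let $S,T$ be $k$-subsets of $\mathbf n=\{1,\ldots,n\}$. Then: (1) $\langle v_S\rangle=\bigoplus_{S'\subseteq\mathbf n,\ S'\le S}Fv_{S'}$ as vector spaces; in particular $V_k=\langle v_{\{n-k+1,\ldots,n\}}\rangle$. (2) $\langle v_T\rangle\subseteq\langle v_S\rangle$ if and only if $T\le S$. (3) $\langle v_S\rangle\cap\langle v_T\rangle=\langle v_{S\wedge T}\rangle$, where $S\wedge T$ is the greatest lower bound of $S$ and $T$.
   Context: $\mathcal{IC}_n$ is the monoid (under composition) of all injective partial maps $f$ from a subset $D(f)\subseteq\mathbf n$ (the domain) onto a subset of $\mathbf n$ which are order preserving ($a<b$ in $D(f)$ implies $f(a)<f(b)$) and order decreasing ($f(a)\le a$ for all $a\in D(f)$); the empty map is included and the identity of $\mathbf n$ is the unit. $F$ is a field of characteristic $0$ and $V$ is the $F$-vector space with basis $\{v_S: S\subseteq\mathbf n\}$, made into an $\mathcal{IC}_n$-module by $f\cdot v_S=v_{f(S)}$ if $S\subseteq D(f)$ and $f\cdot v_S=0$ otherwise, extended linearly. $V_k=\mathrm{span}\{v_S:|S|=k\}$. For $v\in V$, $\langle v\rangle$ is the $\mathcal{IC}_n$-submodule generated by $v$. Partial order on subsets: for $k$-subsets $S=\{s_1<\cdots<s_k\}$, $T=\{t_1<\cdots<t_k\}$, $T\le S$ iff $t_i\le s_i$ for all $i$; subsets of different cardinalities are incomparable. -}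

module Defs where

open import Level using (Level; _⊔_; suc)
open import Algebra.Bundles using (CommutativeRing)
open import Data.Nat as ℕ using (ℕ; zero; _∸_)
import Data.Nat.Properties as ℕP
open import Data.Bool using (Bool; true; false; if_then_else_)
open import Data.Fin using (Fin; toℕ) renaming (zero to fzero; suc to fsuc)
open import Data.Fin.Properties using (any?)
import Data.Fin.Properties as FinP
open import Data.Fin.Subset using (Subset; _∈_; _⊆_; ∣_∣; inside; outside)
open import Data.Fin.Subset.Properties using (_∈?_; _⊆?_)
open import Data.Maybe using (Maybe; just; nothing; is-just)
import Data.Maybe.Properties as MaybeP
open import Data.Vec using (Vec; []; _∷_; tabulate)
import Data.Vec.Properties as VecP
import Data.Bool.Properties as BoolP
open import Data.List using (List; []; _∷_; _++_; map; foldr)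
open import Data.List.Relation.Unary.All using (All)
open import Data.List.Relation.Binary.Pointwise using (Pointwise)
open import Data.Product using (Σ; ∃; _×_; _,_; proj₁; proj₂)
open import Relation.Binary.PropositionalEquality using (_≡_)
open import Relation.Nullary using (¬_; yes; no)
open import Relation.Nullary.Decidable using (⌊_⌋; _×-dec_)

module _ {c ℓ : Level} (R : CommutativeRing c ℓ) where
  open CommutativeRing R

  natToRing : ℕ → Carrier
  natToRing zero      = 0#
  natToRing (ℕ.suc m) = 1# + natToRing m

record IsField {c ℓ : Level} (R : CommutativeRing c ℓ) : Set (c ⊔ ℓ) where
  open CommutativeRing R
  field
    1≉0     : ¬ (1# ≈ 0#)
    inverse : ∀ x → ¬ (x ≈ 0#) → Σ Carrier λ y → (x * y) ≈ 1#

CharZero : {c ℓ : Level} (R : CommutativeRing c ℓ) → Set ℓ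
CharZero R = ∀ m → natToRing R m ≈ 0# → m ≡ 0
  where open CommutativeRing R

-- The monoid IC_n of order-preserving, order-decreasing partial injections
-- of 𝐧 = Fin n (the points 1..n of the paper are 0..n-1 here).

record IC (n : ℕ) : Set where
  field
    fun        : Fin n → Maybe (Fin n)
    injective  : ∀ a b x → fun a ≡ just x → fun b ≡ just x → a ≡ b
    preserving : ∀ a b x y → a Data.Fin.< b → fun a ≡ just x → fun b ≡ just y
                 → x Data.Fin.< y
    decreasing : ∀ a x → fun a ≡ just x → x Data.Fin.≤ a
open IC public

dom : ∀ {n} → IC n → Subset n
dom f = tabulate λ i → is-just (fun f i)

image : ∀ {n} → IC n → Subset n → Subset n
image f S = tabulate λ j →
  ⌊ any? (λ i → (i ∈? S) ×-dec MaybeP.≡-dec FinP._≟_ (fun f i) (just j)) ⌋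

-- The module V, with basis v_S (S ⊆ 𝐧). Vectors are coefficient
-- functions Subset n → F, compared pointwise.

module Module {c ℓ : Level} (R : CommutativeRing c ℓ) (n : ℕ) where
  open CommutativeRing R

  V : Set c
  V = Subset n → Carrier

  _≋_ : V → V → Set ℓ
  v ≋ w = ∀ U → v U ≈ w U

  zeroV : V
  zeroV _ = 0#

  basis : Subset n → V
  basis S U = if ⌊ VecP.≡-dec BoolP._≟_ S U ⌋ then 1# else 0#

  act : IC n → Subset n → V
  act f S = if ⌊ S ⊆? dom f ⌋ then basis (image f S) else zeroV

  lincomb : List (Carrier × V) → V
  lincomb l U = foldr (λ p acc → (proj₁ p * proj₂ p U) + acc) 0# l

  Span : ∀ {p} → (V → Set p) → V → Set (c ⊔ ℓ ⊔ p)
  Span P w = Σ (List (Carrier × V)) λ l →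
               All (λ p → P (proj₂ p)) l × (w ≋ lincomb l)

  -- ⟨ v_S ⟩ : the IC_n-submodule generated by v_S, i.e. the span of the
  -- orbit { f · v_S | f ∈ IC_n }.
  Orbit : Subset n → V → Set ℓ
  Orbit S x = Σ (IC n) λ f → x ≋ act f S

  Gen : Subset n → V → Set (c ⊔ ℓ)
  Gen S = Span (Orbit S)

  BasisSpan : ∀ {p} → (Subset n → Set p) → V → Set (c ⊔ ℓ ⊔ p)
  BasisSpan P = Span (λ x → Σ (Subset n) λ S' → P S' × (x ≋ basis S'))

elems : ∀ {n} → Subset n → List (Fin n)
elems []            = []
elems (true  ∷ bs)  = fzero ∷ map fsuc (elems bs)
elems (false ∷ bs)  = map fsuc (elems bs)

-- T ≤ S iff |T| = |S| = k and t_i ≤ s_i for all i (with t_1<...<t_k,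
-- s_1<...<s_k); subsets of different sizes are incomparable since
-- Pointwise forces equal length.
_≼_ : ∀ {n} → Subset n → Subset n → Set
T ≼ S = Pointwise Data.Fin._≤_ (elems T) (elems S)

IsMeet : ∀ {n} → Subset n → Subset n → Subset n → Set
IsMeet U S T = (U ≼ S) × (U ≼ T) × (∀ W → W ≼ S → W ≼ T → W ≼ U)

-- {n-k+1, ..., n} (0-indexed: indices i with n - k ≤ i)
top : (n k : ℕ) → Subset n
top n k = tabulate λ i → ⌊ (n ∸ k) ℕP.≤? toℕ i ⌋

-- An order-preserving, order-decreasing partial injection f defined on S sends the i-th
-- smallest element of S to the i-th smallest element of f(S), which is no larger; so f·v_S
-- is 0 or some v_T with T ≤ S. Conversely, for T ≤ S the partial map pairing the i-th
-- elements of S and T lies in IC_n. Hence ⟨v_S⟩ is spanned by {v_T : T ≤ S}, and the rest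
-- is read off coefficients in the basis (v_U): vectors of ⟨v_S⟩ vanish outside {T ≤ S},
-- v_T has coefficient 1 at T, and the elementwise minimum S ∧ T of S and T is their meet.
-- Every k-subset lies below {n-k+1,…,n}, as the i-th largest element of a k-subset is at
-- most n-i+1.

module Submission where

open import Defs
open import Level using (Level)
open import Algebra.Bundles using (CommutativeRing)
open import Data.Nat as ℕ using (ℕ; _≤_; _∸_; z≤n; s≤s)
import Data.Nat.Properties as ℕP
open import Data.Fin as Fin using (Fin; toℕ; fromℕ<; _<_) renaming (suc to fsuc)
import Data.Fin.Properties as FinP
open import Data.Fin.Subset using (Subset; ∣_∣) renaming (_∈_ to _∈ₛ_; _⊆_ to _⊆ₛ_)
open import Data.Fin.Subset.Properties using (⊆-antisym; _⊆?_)
open import Data.Bool using (Bool; true; false; T)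
open import Data.Vec using ([]; _∷_; tabulate; here; there)
open import Data.Vec.Properties as VecP using (lookup∘tabulate; []=⇒lookup; lookup⇒[]=)
open import Data.Bool.Properties as BoolP using (T-≡)
open import Data.List using (List; []; _∷_; _++_; map; length; zipWith; zip)
open import Data.List.Properties using (length-map)
open import Data.List.Membership.Propositional using (_∈_)
open import Data.List.Membership.Propositional.Properties using (∈-map⁺; ∈-map⁻)
open import Data.List.Relation.Unary.Any using (here; there)
open import Data.List.Relation.Unary.All as All using (All; []; _∷_)
import Data.List.Relation.Unary.All.Properties as AllP
open import Data.List.Relation.Unary.AllPairs as AllPairs using (AllPairs; []; _∷_)
import Data.List.Relation.Unary.AllPairs.Properties as AllPairsP
open import Data.List.Relation.Binary.Pointwise using (Pointwise; []; _∷_; Pointwise-length)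
import Data.List.Relation.Binary.Pointwise.Properties as PointwiseP
open import Data.Product using (Σ; ∃; _×_; _,_; proj₁; proj₂; map₁)
open import Data.Sum using (_⊎_; inj₁; inj₂)
open import Data.Empty using (⊥-elim)
open import Data.Maybe using (Maybe; just; nothing; is-just)
open import Data.Maybe.Properties using (just-injective)
open import Function using (_∘_; id)
open import Function.Bundles using (_⇔_; mk⇔; Equivalence)
open import Relation.Nullary using (¬_; Dec; yes; no)
open import Relation.Unary using (Decidable)
open import Relation.Nullary.Decidable using (⌊_⌋; toWitness; fromWitness)
open import Relation.Binary.PropositionalEquality using (_≡_; _≢_; refl; sym; trans; cong; subst)

module _ {A B C : Set} (f : A → B → C) where

  All-zipWith : ∀ {p q r} {P : A → Set p} {Q : B → Set q} {R : C → Set r} →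
                (∀ {a b} → P a → Q b → R (f a b)) →
                ∀ {xs ys} → All P xs → All Q ys → All R (zipWith f xs ys)
  All-zipWith g []       _        = []
  All-zipWith g (_ ∷ _)  []       = []
  All-zipWith g (p ∷ ps) (q ∷ qs) = g p q ∷ All-zipWith g ps qs

  AllPairs-zipWith : ∀ {r s t} {R : A → A → Set r} {S : B → B → Set s} {T : C → C → Set t} →
                     (∀ {a b c d} → R a c → S b d → T (f a b) (f c d)) →
                     ∀ {xs ys} → AllPairs R xs → AllPairs S ys → AllPairs T (zipWith f xs ys)
  AllPairs-zipWith g []         _          = []
  AllPairs-zipWith g (_ ∷ _)    []         = []
  AllPairs-zipWith g (p ∷ <xs) (q ∷ <ys) = All-zipWith g p q ∷ AllPairs-zipWith g <xs <ys

module _ {A : Set} where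

  AllPairs-∈ : ∀ {r} {R : A → A → Set r} {xs x y} → AllPairs R xs → x ∈ xs → y ∈ xs →
               x ≡ y ⊎ R x y ⊎ R y x
  AllPairs-∈ _          (here refl) (here refl) = inj₁ refl
  AllPairs-∈ (Rx ∷ _)   (here refl) (there y∈)  = inj₂ (inj₁ (All.lookup Rx y∈))
  AllPairs-∈ (Rx ∷ _)   (there x∈)  (here refl) = inj₂ (inj₂ (All.lookup Rx x∈))
  AllPairs-∈ (_  ∷ Rxs) (there x∈)  (there y∈)  = AllPairs-∈ Rxs x∈ y∈

  module _ {B : Set} where

    ∈-zip⁻ : ∀ {xs : List A} {ys : List B} {x y} → (x , y) ∈ zip xs ys → x ∈ xs × y ∈ ys
    ∈-zip⁻ {_ ∷ _} {_ ∷ _} (here refl) = here refl , here refl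
    ∈-zip⁻ {_ ∷ _} {_ ∷ _} (there p)   = let x∈ , y∈ = ∈-zip⁻ p in there x∈ , there y∈

    ∈-zipˡ : ∀ {r} {R : A → B → Set r} {xs ys x} → Pointwise R xs ys → x ∈ xs →
             ∃ λ y → (x , y) ∈ zip xs ys
    ∈-zipˡ (_ ∷ _)  (here refl) = _ , here refl
    ∈-zipˡ (_ ∷ Rs) (there x∈)  = let y , p = ∈-zipˡ Rs x∈ in y , there p

    ∈-zipʳ : ∀ {r} {R : A → B → Set r} {xs ys y} → Pointwise R xs ys → y ∈ ys →
             ∃ λ x → (x , y) ∈ zip xs ys
    ∈-zipʳ (_ ∷ _)  (here refl) = _ , here refl
    ∈-zipʳ (_ ∷ Rs) (there y∈)  = let x , p = ∈-zipʳ Rs y∈ in x , there p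

module _ {n : ℕ} where

  ∈-tabulate⁻ : ∀ {g : Fin n → Bool} {i} → i ∈ₛ tabulate g → T (g i)
  ∈-tabulate⁻ {g} {i} p = Equivalence.from T-≡ (trans (sym (lookup∘tabulate g i)) ([]=⇒lookup p))

  ∈-tabulate⁺ : ∀ {g : Fin n → Bool} {i} → T (g i) → i ∈ₛ tabulate g
  ∈-tabulate⁺ {g} {i} t = lookup⇒[]= i (tabulate g) (trans (lookup∘tabulate g i) (Equivalence.to T-≡ t))

elems-increasing : ∀ {n} (S : Subset n) → AllPairs _<_ (elems S)
elems-increasing []          = []
elems-increasing (true ∷ S)  =
  AllP.map⁺ (All.universal (λ _ → s≤s z≤n) _) ∷ AllPairsP.map⁺ (AllPairs.map s≤s (elems-increasing S))
elems-increasing (false ∷ S) = AllPairsP.map⁺ (AllPairs.map s≤s (elems-increasing S))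

∈-elems⁺ : ∀ {n} (S : Subset n) {i} → i ∈ₛ S → i ∈ elems S
∈-elems⁺ (true ∷ S)  here      = here refl
∈-elems⁺ (true ∷ S)  (there p) = there (∈-map⁺ fsuc (∈-elems⁺ S p))
∈-elems⁺ (false ∷ S) (there p) = ∈-map⁺ fsuc (∈-elems⁺ S p)

∈-elems⁻ : ∀ {n} (S : Subset n) {i} → i ∈ elems S → i ∈ₛ S
∈-elems⁻ (true ∷ S)  (here refl) = here
∈-elems⁻ (true ∷ S)  (there p)   with ∈-map⁻ fsuc p
... | _ , q , refl = there (∈-elems⁻ S q)
∈-elems⁻ (false ∷ S) p           with ∈-map⁻ fsuc p
... | _ , q , refl = there (∈-elems⁻ S q)

length-elems : ∀ {n} (S : Subset n) → length (elems S) ≡ ∣ S ∣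
length-elems []          = refl
length-elems (true ∷ S)  = cong ℕ.suc (trans (length-map fsuc (elems S)) (length-elems S))
length-elems (false ∷ S) = trans (length-map fsuc (elems S)) (length-elems S)

increasing-ext : ∀ {n} {xs ys : List (Fin n)} → AllPairs _<_ xs → AllPairs _<_ ys →
                 (∀ {i} → i ∈ xs → i ∈ ys) → (∀ {i} → i ∈ ys → i ∈ xs) → xs ≡ ys
increasing-ext []       []       _    _    = refl
increasing-ext []       (_ ∷ _)  _    ys⊆ with () ← ys⊆ (here refl)
increasing-ext (_ ∷ _)  []       xs⊆ _    with () ← xs⊆ (here refl)
increasing-ext {xs = x ∷ xs} {y ∷ ys} (x< ∷ <xs) (y< ∷ <ys) xs⊆ ys⊆
  with xs⊆ (here refl) | ys⊆ (here refl)
... | here refl | _         = cong (x ∷_) (increasing-ext <xs <ys (⊆-tail x< xs⊆) (⊆-tail y< ys⊆))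
  where
  ⊆-tail : ∀ {zs ws} → All (x <_) zs → (∀ {i} → i ∈ x ∷ zs → i ∈ x ∷ ws) → ∀ {i} → i ∈ zs → i ∈ ws
  ⊆-tail x<zs ⊆ i∈ with ⊆ (there i∈)
  ... | here refl  = ⊥-elim (ℕP.<-irrefl refl (All.lookup x<zs i∈))
  ... | there i∈ws = i∈ws
... | there y∈  | here refl = ⊥-elim (ℕP.<-irrefl refl (All.lookup y< y∈))
... | there y∈  | there x∈  = ⊥-elim (ℕP.<-asym (All.lookup x< x∈) (All.lookup y< y∈))

elems-tabulate : ∀ {n} {g : Fin n → Bool} {xs} → AllPairs _<_ xs →
                 (∀ {i} → T (g i) → i ∈ xs) → (∀ {i} → i ∈ xs → T (g i)) → elems (tabulate g) ≡ xs
elems-tabulate {g = g} <xs g⇒∈ ∈⇒g = increasing-ext (elems-increasing (tabulate g)) <xs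
  (g⇒∈ ∘ ∈-tabulate⁻ ∘ ∈-elems⁻ (tabulate g)) (∈-elems⁺ (tabulate g) ∘ ∈-tabulate⁺ ∘ ∈⇒g)

module _ {n : ℕ} where

  ≼-refl : (S : Subset n) → S ≼ S
  ≼-refl S = PointwiseP.refl ℕP.≤-refl

  ≼-trans : {S T U : Subset n} → S ≼ T → T ≼ U → S ≼ U
  ≼-trans = PointwiseP.transitive ℕP.≤-trans

  _≼?_ : (S T : Subset n) → Dec (S ≼ T)
  S ≼? T = PointwiseP.decidable FinP._≤?_ (elems S) (elems T)

  fromList : List (Fin n) → Subset n
  fromList xs = tabulate λ i → ⌊ i ∈? xs ⌋
    where open import Data.List.Membership.DecPropositional (FinP._≟_ {n}) using (_∈?_)

  elems-fromList : ∀ {xs} → AllPairs _<_ xs → elems (fromList xs) ≡ xs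
  elems-fromList <xs = elems-tabulate <xs toWitness fromWitness

module _ {n : ℕ} where

  open import Algebra.Construct.NaturalChoice.Min (FinP.≤-totalOrder n)
    using (_⊓_; x⊓y≤x; x⊓y≤y; ⊓-glb; ⊓-sel)

  ⊓-mono-< : {a b c d : Fin n} → a < c → b < d → a ⊓ b < c ⊓ d
  ⊓-mono-< {a} {b} {c} {d} a<c b<d with c ⊓ d | ⊓-sel c d
  ... | _ | inj₁ refl = ℕP.≤-<-trans (x⊓y≤x a b) a<c
  ... | _ | inj₂ refl = ℕP.≤-<-trans (x⊓y≤y a b) b<d

  zipWith-⊓-≤ˡ : ∀ {xs ys} → length xs ≡ length ys → Pointwise Fin._≤_ (zipWith _⊓_ xs ys) xs
  zipWith-⊓-≤ˡ {[]}     {[]}     _  = []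
  zipWith-⊓-≤ˡ {x ∷ xs} {y ∷ ys} eq = x⊓y≤x x y ∷ zipWith-⊓-≤ˡ (ℕP.suc-injective eq)

  zipWith-⊓-≤ʳ : ∀ {xs ys} → length xs ≡ length ys → Pointwise Fin._≤_ (zipWith _⊓_ xs ys) ys
  zipWith-⊓-≤ʳ {[]}     {[]}     _  = []
  zipWith-⊓-≤ʳ {x ∷ xs} {y ∷ ys} eq = x⊓y≤y x y ∷ zipWith-⊓-≤ʳ (ℕP.suc-injective eq)

  zipWith-⊓-glb : ∀ {ws xs ys} → Pointwise Fin._≤_ ws xs → Pointwise Fin._≤_ ws ys →
                  Pointwise Fin._≤_ ws (zipWith _⊓_ xs ys)
  zipWith-⊓-glb []         []         = []
  zipWith-⊓-glb (w≤x ∷ ≤xs) (w≤y ∷ ≤ys) = ⊓-glb w≤x w≤y ∷ zipWith-⊓-glb ≤xs ≤ys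

  _∧_ : Subset n → Subset n → Subset n
  S ∧ T = fromList (zipWith _⊓_ (elems S) (elems T))

  ∧-isMeet : (S T : Subset n) → ∣ S ∣ ≡ ∣ T ∣ → IsMeet (S ∧ T) S T
  ∧-isMeet S T ∣S∣≡∣T∣ =
    isMeet {S ∧ T} (elems-fromList (AllPairs-zipWith _⊓_ ⊓-mono-< (elems-increasing S) (elems-increasing T)))
    where
    length≡ : length (elems S) ≡ length (elems T)
    length≡ = trans (length-elems S) (trans ∣S∣≡∣T∣ (sym (length-elems T)))
    isMeet : ∀ {U} → elems U ≡ zipWith _⊓_ (elems S) (elems T) → IsMeet U S T
    isMeet eq rewrite eq = zipWith-⊓-≤ˡ length≡ , zipWith-⊓-≤ʳ length≡ , λ _ → zipWith-⊓-glb

module _ {n : ℕ} where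

  private
    n∸[1+k]<n : ∀ {k} → ℕ.suc k ≤ n → n ∸ ℕ.suc k ℕ.< n
    n∸[1+k]<n = ℕP.∸-monoʳ-< (s≤s z≤n)

    1+[n∸[1+k]]≡n∸k : ∀ {k} → ℕ.suc k ≤ n → ℕ.suc (n ∸ ℕ.suc k) ≡ n ∸ k
    1+[n∸[1+k]]≡n∸k k<n = sym (ℕP.+-∸-assoc 1 k<n)

  topList : (k : ℕ) → k ≤ n → List (Fin n)
  topList ℕ.zero    _   = []
  topList (ℕ.suc k) k<n = fromℕ< (n∸[1+k]<n k<n) ∷ topList k (ℕP.<⇒≤ k<n)

  length-topList : ∀ k (k≤n : k ≤ n) → length (topList k k≤n) ≡ k
  length-topList ℕ.zero    _   = refl
  length-topList (ℕ.suc k) k<n = cong ℕ.suc (length-topList k _)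

  ∈-topList⁻ : ∀ k (k≤n : k ≤ n) {i} → i ∈ topList k k≤n → n ∸ k ≤ toℕ i
  ∈-topList⁻ (ℕ.suc k) k<n (here refl) = ℕP.≤-reflexive (sym (FinP.toℕ-fromℕ< (n∸[1+k]<n k<n)))
  ∈-topList⁻ (ℕ.suc k) k<n (there i∈) = ℕP.≤-trans (ℕP.∸-monoʳ-≤ n (ℕP.n≤1+n k)) (∈-topList⁻ k _ i∈)

  ∈-topList⁺ : ∀ k (k≤n : k ≤ n) {i} → n ∸ k ≤ toℕ i → i ∈ topList k k≤n
  ∈-topList⁺ ℕ.zero    _   {i} n≤i = ⊥-elim (ℕP.<⇒≱ (FinP.toℕ<n i) n≤i)
  ∈-topList⁺ (ℕ.suc k) k<n {i} ≤i with toℕ i ℕP.≟ n ∸ ℕ.suc k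
  ... | yes i≡ = here (FinP.toℕ-injective (trans i≡ (sym (FinP.toℕ-fromℕ< (n∸[1+k]<n k<n)))))
  ... | no  i≢ =
    there (∈-topList⁺ k _ (subst (_≤ toℕ i) (1+[n∸[1+k]]≡n∸k k<n) (ℕP.≤∧≢⇒< ≤i (i≢ ∘ sym))))

  topList-increasing : ∀ k (k≤n : k ≤ n) → AllPairs _<_ (topList k k≤n)
  topList-increasing ℕ.zero    _   = []
  topList-increasing (ℕ.suc k) k<n = All.tabulate head< ∷ topList-increasing k _
    where
    head< : ∀ {z} → z ∈ topList k _ → fromℕ< (n∸[1+k]<n k<n) < z
    head< {z} z∈ = subst (ℕ._< toℕ z) (sym (FinP.toℕ-fromℕ< (n∸[1+k]<n k<n)))
                     (subst (_≤ toℕ z) (sym (1+[n∸[1+k]]≡n∸k k<n)) (∈-topList⁻ k _ z∈))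

  elems-top : ∀ k (k≤n : k ≤ n) → elems (top n k) ≡ topList k k≤n
  elems-top k k≤n = elems-tabulate (topList-increasing k k≤n)
    (∈-topList⁺ k k≤n ∘ toWitness) (fromWitness ∘ ∈-topList⁻ k k≤n)

  increasing-head+length<n : ∀ {x} {xs : List (Fin n)} → AllPairs _<_ (x ∷ xs) → toℕ x ℕ.+ length xs ℕ.< n
  increasing-head+length<n {x} {[]}     _ = subst (ℕ._< n) (sym (ℕP.+-identityʳ (toℕ x))) (FinP.toℕ<n x)
  increasing-head+length<n {x} {y ∷ ys} ((x<y ∷ _) ∷ <ys) =
    subst (ℕ._< n) (sym (ℕP.+-suc (toℕ x) (length ys)))
      (ℕP.≤-<-trans (ℕP.+-monoˡ-≤ (length ys) x<y) (increasing-head+length<n <ys))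

  increasing⇒≤topList : ∀ k (k≤n : k ≤ n) {xs : List (Fin n)} → AllPairs _<_ xs → length xs ≡ k →
                        Pointwise Fin._≤_ xs (topList k k≤n)
  increasing⇒≤topList ℕ.zero    _   {[]}     _   _      = []
  increasing⇒≤topList (ℕ.suc k) k<n {x ∷ xs} <xs len≡ with refl ← ℕP.suc-injective len≡ =
    subst (toℕ x ≤_) (sym (FinP.toℕ-fromℕ< (n∸[1+k]<n k<n)))
      (ℕP.m+n≤o⇒m≤o∸n (toℕ x)
        (subst (_≤ n) (sym (ℕP.+-suc (toℕ x) (length xs))) (increasing-head+length<n <xs)))
    ∷ increasing⇒≤topList k _ (AllPairs.tail <xs) refl

  ≼-top⇔∣∣≡ : ∀ k → k ≤ n → (X : Subset n) → X ≼ top n k ⇔ ∣ X ∣ ≡ k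
  ≼-top⇔∣∣≡ k k≤n X rewrite elems-top k k≤n = mk⇔
    (λ X≼top → trans (sym (length-elems X)) (trans (Pointwise-length X≼top) (length-topList k k≤n)))
    (λ ∣X∣≡k → increasing⇒≤topList k k≤n (elems-increasing X) (trans (length-elems X) ∣X∣≡k))

module _ {n : ℕ} (f : IC n) where

  dom⁻ : ∀ {i} → i ∈ₛ dom f → ∃ λ j → fun f i ≡ just j
  dom⁻ {i} i∈ with fun f i | ∈-tabulate⁻ {g = is-just ∘ fun f} i∈
  ... | just j | _ = j , refl

  dom⁺ : ∀ {i j} → fun f i ≡ just j → i ∈ₛ dom f
  dom⁺ fi≡ = ∈-tabulate⁺ {g = is-just ∘ fun f} (subst (T ∘ is-just) (sym fi≡) _)

  image⁻ : ∀ {S j} → j ∈ₛ image f S → ∃ λ i → i ∈ₛ S × fun f i ≡ just j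
  image⁻ = toWitness ∘ ∈-tabulate⁻

  image⁺ : ∀ {S i j} → i ∈ₛ S → fun f i ≡ just j → j ∈ₛ image f S
  image⁺ i∈ fi≡ = ∈-tabulate⁺ (fromWitness (_ , i∈ , fi≡))

  Defined : Fin n → Set
  Defined i = ∃ λ j → fun f i ≡ just j

  images : ∀ {xs} → All Defined xs → List (Fin n)
  images []             = []
  images ((j , _) ∷ ds) = j ∷ images ds

  ∈-images⁻ : ∀ {xs} (ds : All Defined xs) {j} → j ∈ images ds → ∃ λ i → i ∈ xs × fun f i ≡ just j
  ∈-images⁻ ((_ , fx≡) ∷ ds) (here refl) = _ , here refl , fx≡
  ∈-images⁻ (_ ∷ ds)          (there j∈)  with ∈-images⁻ ds j∈
  ... | i , i∈ , fi≡ = i , there i∈ , fi≡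

  ∈-images⁺ : ∀ {xs} (ds : All Defined xs) {i j} → i ∈ xs → fun f i ≡ just j → j ∈ images ds
  ∈-images⁺ ((_ , fx≡) ∷ ds) (here refl) fi≡ = here (just-injective (trans (sym fi≡) fx≡))
  ∈-images⁺ (_ ∷ ds)          (there i∈)  fi≡ = there (∈-images⁺ ds i∈ fi≡)

  images-above : ∀ {i j xs} (ds : All Defined xs) → fun f i ≡ just j → All (i <_) xs → All (j <_) (images ds)
  images-above []                 _   []           = []
  images-above ((_ , fx≡) ∷ ds) fi≡ (i<x ∷ i<xs) =
    preserving f _ _ _ _ i<x fi≡ fx≡ ∷ images-above ds fi≡ i<xs

  images-increasing : ∀ {xs} (ds : All Defined xs) → AllPairs _<_ xs → AllPairs _<_ (images ds)
  images-increasing []                 []            = []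
  images-increasing ((_ , fx≡) ∷ ds) (x< ∷ <xs) = images-above ds fx≡ x< ∷ images-increasing ds <xs

  images-≤ : ∀ {xs} (ds : All Defined xs) → Pointwise Fin._≤_ (images ds) xs
  images-≤ []                 = []
  images-≤ ((_ , fx≡) ∷ ds) = decreasing f _ _ fx≡ ∷ images-≤ ds

  image-≼ : ∀ {S} → S ⊆ₛ dom f → image f S ≼ S
  image-≼ {S} S⊆dom = subst (λ ys → Pointwise Fin._≤_ ys (elems S)) (sym elems-image) (images-≤ ds)
    where
    ds : All Defined (elems S)
    ds = All.tabulate (dom⁻ ∘ S⊆dom ∘ ∈-elems⁻ S)
    elems-image : elems (image f S) ≡ images ds
    elems-image = elems-tabulate (images-increasing ds (elems-increasing S))
      (λ t → let i , i∈ , fi≡ = toWitness t in ∈-images⁺ ds (∈-elems⁺ S i∈) fi≡)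
      (λ j∈ → let i , i∈ , fi≡ = ∈-images⁻ ds j∈ in fromWitness (i , ∈-elems⁻ S i∈ , fi≡))

module _ {n : ℕ} where

  PairsIncreasing : List (Fin n × Fin n) → Set
  PairsIncreasing = AllPairs λ p q → proj₁ p < proj₁ q × proj₂ p < proj₂ q

  lookupPair : List (Fin n × Fin n) → Fin n → Maybe (Fin n)
  lookupPair []             i = nothing
  lookupPair ((a , b) ∷ ps) i with a FinP.≟ i
  ... | yes _ = just b
  ... | no  _ = lookupPair ps i

  lookupPair-sound : ∀ ps {i j} → lookupPair ps i ≡ just j → (i , j) ∈ ps
  lookupPair-sound ((a , b) ∷ ps) {i} eq with a FinP.≟ i | eq
  ... | yes refl | refl = here refl
  ... | no  _    | eq′  = there (lookupPair-sound ps eq′)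

  lookupPair-complete : ∀ {ps i j} → PairsIncreasing ps → (i , j) ∈ ps → lookupPair ps i ≡ just j
  lookupPair-complete {(a , b) ∷ ps} {i} (a< ∷ <ps) p∈ with a FinP.≟ i | p∈
  ... | yes refl | here refl = refl
  ... | yes refl | there q∈  = ⊥-elim (ℕP.<-irrefl refl (proj₁ (All.lookup a< q∈)))
  ... | no  a≢i  | here refl = ⊥-elim (a≢i refl)
  ... | no  _    | there q∈  = lookupPair-complete <ps q∈

  fromPairs : (ps : List (Fin n × Fin n)) → PairsIncreasing ps →
              All (λ p → proj₂ p Fin.≤ proj₁ p) ps → IC n
  fromPairs ps <ps ≥ps = record
    { fun        = lookupPair ps
    ; injective  = injective′
    ; preserving = preserving′
    ; decreasing = λ _ _ → All.lookup ≥ps ∘ lookupPair-sound ps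
    }
    where
    injective′ : ∀ a b j → lookupPair ps a ≡ just j → lookupPair ps b ≡ just j → a ≡ b
    injective′ _ _ _ fa≡ fb≡ with AllPairs-∈ <ps (lookupPair-sound ps fa≡) (lookupPair-sound ps fb≡)
    ... | inj₁ refl             = refl
    ... | inj₂ (inj₁ (_ , j<j)) = ⊥-elim (ℕP.<-irrefl refl j<j)
    ... | inj₂ (inj₂ (_ , j<j)) = ⊥-elim (ℕP.<-irrefl refl j<j)
    preserving′ : ∀ a b x y → a < b → lookupPair ps a ≡ just x → lookupPair ps b ≡ just y → x < y
    preserving′ _ _ _ _ a<b fa≡ fb≡ with AllPairs-∈ <ps (lookupPair-sound ps fa≡) (lookupPair-sound ps fb≡)
    ... | inj₁ refl             = ⊥-elim (ℕP.<-irrefl refl a<b)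
    ... | inj₂ (inj₁ (_ , x<y)) = x<y
    ... | inj₂ (inj₂ (b<a , _)) = ⊥-elim (ℕP.<-asym a<b b<a)

  -- The map sending the i-th element of S to the i-th element of T.
  ≼⇒image : ∀ {S T : Subset n} → T ≼ S → ∃ λ f → S ⊆ₛ dom f × image f S ≡ T
  ≼⇒image {S} {T} T≼S = f , S⊆dom , ⊆-antisym image⊆T T⊆image
    where
    ps = zip (elems S) (elems T)
    <ps : PairsIncreasing ps
    <ps = AllPairs-zipWith _,_ _,_ (elems-increasing S) (elems-increasing T)
    S≥T : Pointwise (λ s t → t Fin.≤ s) (elems S) (elems T)
    S≥T = PointwiseP.symmetric id T≼S
    f = fromPairs ps <ps (AllP.zipWith⁺ _,_ S≥T)
    S⊆dom : S ⊆ₛ dom f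
    S⊆dom s∈ = dom⁺ f (lookupPair-complete <ps (proj₂ (∈-zipˡ S≥T (∈-elems⁺ S s∈))))
    image⊆T : image f S ⊆ₛ T
    image⊆T t∈ = let _ , _ , fs≡ = image⁻ f t∈ in
      ∈-elems⁻ T (proj₂ (∈-zip⁻ (lookupPair-sound ps fs≡)))
    T⊆image : T ⊆ₛ image f S
    T⊆image t∈ = let _ , p∈ = ∈-zipʳ S≥T (∈-elems⁺ T t∈) in
      image⁺ f (∈-elems⁻ S (proj₁ (∈-zip⁻ p∈))) (lookupPair-complete <ps p∈)

module Linear {c ℓ : Level} (R : CommutativeRing c ℓ) (n : ℕ) where

  open CommutativeRing R renaming (refl to ≈-refl; sym to ≈-sym; trans to ≈-trans)
  open Module R n
  open import Relation.Binary.Reasoning.Setoid setoid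

  BasisVector : ∀ {p} → (Subset n → Set p) → V → Set _
  BasisVector P v = ∃ λ X → P X × v ≋ basis X

  basis-≢ : ∀ {X Y} → X ≢ Y → basis X Y ≈ 0#
  basis-≢ {X} {Y} X≢Y with VecP.≡-dec BoolP._≟_ X Y
  ... | yes X≡Y = ⊥-elim (X≢Y X≡Y)
  ... | no  _   = ≈-refl

  basis-diag : ∀ X → basis X X ≈ 1#
  basis-diag X with VecP.≡-dec BoolP._≟_ X X
  ... | yes _   = ≈-refl
  ... | no  X≢X = ⊥-elim (X≢X refl)

  act-⊆ : ∀ {f S} → S ⊆ₛ dom f → act f S ≡ basis (image f S)
  act-⊆ {f} {S} S⊆dom with S ⊆? dom f
  ... | yes _   = refl
  ... | no  S⊈ = ⊥-elim (S⊈ S⊆dom)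

  scaleAll : Carrier → List (Carrier × V) → List (Carrier × V)
  scaleAll a = map (map₁ (a *_))

  lincomb-++ : ∀ l l′ U → lincomb (l ++ l′) U ≈ lincomb l U + lincomb l′ U
  lincomb-++ []             l′ U = ≈-sym (+-identityˡ _)
  lincomb-++ ((a , v) ∷ l) l′ U = ≈-trans (+-congˡ (lincomb-++ l l′ U)) (≈-sym (+-assoc _ _ _))

  lincomb-scaleAll : ∀ a l U → lincomb (scaleAll a l) U ≈ a * lincomb l U
  lincomb-scaleAll a []             U = ≈-sym (zeroʳ a)
  lincomb-scaleAll a ((b , v) ∷ l) U =
    ≈-trans (+-cong (*-assoc a b (v U)) (lincomb-scaleAll a l U)) (≈-sym (distribˡ a _ _))

  Span-zero : ∀ {p} {P : V → Set p} → Span P zeroV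
  Span-zero = [] , [] , λ _ → ≈-refl

  Span-∈ : ∀ {p} {P : V → Set p} {v} → P v → Span P v
  Span-∈ {v = v} Pv = (1# , v) ∷ [] , Pv ∷ [] , λ U → ≈-sym (≈-trans (+-identityʳ _) (*-identityˡ _))

  Span-resp-≋ : ∀ {p} {P : V → Set p} {v w} → w ≋ v → Span P v → Span P w
  Span-resp-≋ w≋v (l , Pl , v≋) = l , Pl , λ U → ≈-trans (w≋v U) (v≋ U)

  Span-least : ∀ {p q} {P : V → Set p} {Q : V → Set q} →
               (∀ {v} → P v → Span Q v) → ∀ {w} → Span P w → Span Q w
  Span-least {P = P} {Q = Q} P⊆ (l , Pl , w≋) = Span-resp-≋ w≋ (lincomb∈Span l Pl)
    where
    lincomb∈Span : ∀ l → All (P ∘ proj₂) l → Span Q (lincomb l)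
    lincomb∈Span []             []        = Span-zero
    lincomb∈Span ((a , v) ∷ l) (Pv ∷ Pl) with P⊆ Pv | lincomb∈Span l Pl
    ... | lv , Qlv , v≋ | lr , Qlr , r≋ = scaleAll a lv ++ lr , AllP.++⁺ (AllP.map⁺ Qlv) Qlr , λ U → begin
      a * v U + lincomb l U                                ≈⟨ +-cong (*-congˡ (v≋ U)) (r≋ U) ⟩
      a * lincomb lv U + lincomb lr U                      ≈⟨ +-congʳ (lincomb-scaleAll a lv U) ⟨
      lincomb (scaleAll a lv) U + lincomb lr U             ≈⟨ lincomb-++ (scaleAll a lv) lr U ⟨
      lincomb (scaleAll a lv ++ lr) U                      ∎

  BasisSpan-mono : ∀ {p q} {P : Subset n → Set p} {Q : Subset n → Set q} →
                   (∀ {X} → P X → Q X) → ∀ {w} → BasisSpan P w → BasisSpan Q w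
  BasisSpan-mono P⊆Q = Span-least λ (X , PX , v≋) → Span-∈ (X , P⊆Q PX , v≋)

  private
    scaled-basis-≢ : ∀ {a v X Y} → v ≋ basis X → X ≢ Y → a * v Y ≈ 0#
    scaled-basis-≢ {a} {v} {X} {Y} v≋ X≢Y = begin
      a * v Y       ≈⟨ *-congˡ (≈-trans (v≋ Y) (basis-≢ X≢Y)) ⟩
      a * 0#        ≈⟨ zeroʳ a ⟩
      0#            ∎

  BasisSpan-vanishes : ∀ {q} {Q : Subset n → Set q} {w} → BasisSpan Q w → ∀ {X} → ¬ Q X → w X ≈ 0#
  BasisSpan-vanishes {Q = Q} (l , Bl , w≋) {X} ¬QX = ≈-trans (w≋ X) (lincomb-vanishes l Bl)
    where
    lincomb-vanishes : ∀ l → All (BasisVector Q ∘ proj₂) l → lincomb l X ≈ 0#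
    lincomb-vanishes []             []                    = ≈-refl
    lincomb-vanishes ((a , v) ∷ l) ((Y , QY , v≋) ∷ Bl) =
      ≈-trans (+-cong (scaled-basis-≢ v≋ λ { refl → ¬QX QY }) (lincomb-vanishes l Bl)) (+-identityʳ 0#)

  BasisSpan-restrict : ∀ {p q} {P : Subset n → Set p} {Q : Subset n → Set q} → Decidable P →
                       ∀ {w} → BasisSpan Q w → ∃ λ w′ → BasisSpan P w′ × (∀ {Y} → P Y → w Y ≈ w′ Y)
  BasisSpan-restrict {P = P} {Q} P? (l , Bl , w≋) =
    let l′ , Bl′ , l≈l′ = restrict l Bl
    in lincomb l′ , (l′ , Bl′ , λ _ → ≈-refl) , λ {Y} PY → ≈-trans (w≋ Y) (l≈l′ PY)
    where
    restrict : ∀ l → All (BasisVector Q ∘ proj₂) l →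
               ∃ λ l′ → All (BasisVector P ∘ proj₂) l′ × (∀ {Y} → P Y → lincomb l Y ≈ lincomb l′ Y)
    restrict []             []                  = [] , [] , λ _ → ≈-refl
    restrict ((a , v) ∷ l) ((X , _ , v≋) ∷ Bl) with restrict l Bl | P? X
    ... | l′ , Bl′ , l≈l′ | yes PX = (a , v) ∷ l′ , (X , PX , v≋) ∷ Bl′ , λ PY → +-congˡ (l≈l′ PY)
    ... | l′ , Bl′ , l≈l′ | no ¬PX = l′ , Bl′ , λ PY →
      ≈-trans (+-cong (scaled-basis-≢ v≋ λ { refl → ¬PX PY }) (l≈l′ PY)) (+-identityˡ _)

  Orbit⇒BasisSpan : ∀ {S v} → Orbit S v → BasisSpan (_≼ S) v
  Orbit⇒BasisSpan {S} (f , v≋) with S ⊆? dom f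
  ... | yes S⊆dom = Span-∈ (image f S , image-≼ f S⊆dom , v≋)
  ... | no  _     = Span-resp-≋ v≋ Span-zero

  Gen⇒BasisSpan : ∀ S {w} → Gen S w → BasisSpan (_≼ S) w
  Gen⇒BasisSpan S = Span-least (Orbit⇒BasisSpan {S})

  BasisSpan⇒Gen : ∀ S {w} → BasisSpan (_≼ S) w → Gen S w
  BasisSpan⇒Gen S = Span-least λ {v} (T , T≼S , v≋) →
    let f , S⊆dom , fS≡T = ≼⇒image {S = S} {T} T≼S
    in Span-∈ (f , subst (v ≋_) (sym (trans (act-⊆ {f} {S} S⊆dom) (cong basis fS≡T))) v≋)

  Gen-mono : ∀ S T → T ≼ S → ∀ {w} → Gen T w → Gen S w
  Gen-mono S T T≼S =
    BasisSpan⇒Gen S ∘ BasisSpan-mono (λ {X} X≼T → ≼-trans {S = X} {T} {S} X≼T T≼S) ∘ Gen⇒BasisSpan T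

  BasisSpan-∣∣≡⇔Gen-top : ∀ {k} → k ≤ n → ∀ {w} → BasisSpan (λ U → ∣ U ∣ ≡ k) w ⇔ Gen (top n k) w
  BasisSpan-∣∣≡⇔Gen-top {k} k≤n = mk⇔
    (BasisSpan⇒Gen (top n k) ∘ BasisSpan-mono (λ {X} → Equivalence.from (≼-top⇔∣∣≡ k k≤n X)))
    (BasisSpan-mono (λ {X} → Equivalence.to (≼-top⇔∣∣≡ k k≤n X)) ∘ Gen⇒BasisSpan (top n k))

  basis∈Gen : ∀ S → Gen S (basis S)
  basis∈Gen S = BasisSpan⇒Gen S (Span-∈ (S , ≼-refl S , λ _ → ≈-refl))

  Gen⊆Gen⇔≼ : ¬ 1# ≈ 0# → ∀ S T → (∀ w → Gen T w → Gen S w) ⇔ T ≼ S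
  Gen⊆Gen⇔≼ 1≉0 S T = mk⇔ Gen⊆Gen⇒≼ (λ T≼S _ → Gen-mono S T T≼S)
    where
    Gen⊆Gen⇒≼ : (∀ w → Gen T w → Gen S w) → T ≼ S
    Gen⊆Gen⇒≼ Gen[T]⊆Gen[S] with T ≼? S
    ... | yes T≼S = T≼S
    ... | no  T⋠S = ⊥-elim (1≉0 (≈-trans (≈-sym (basis-diag T))
                      (BasisSpan-vanishes (Gen⇒BasisSpan S (Gen[T]⊆Gen[S] _ (basis∈Gen T))) T⋠S)))

  Gen∩Gen⇒Gen-meet : ∀ S T U → IsMeet U S T → ∀ {w} → Gen S w → Gen T w → Gen U w
  Gen∩Gen⇒Gen-meet S T U (_ , _ , glb) {w} w∈S w∈T =
    let w′ , w′∈U , w≈w′ = BasisSpan-restrict (_≼? U) (Gen⇒BasisSpan S w∈S)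
    in BasisSpan⇒Gen U (Span-resp-≋ (w≋ w′∈U w≈w′) w′∈U)
    where
    vanishes : ∀ {Y} → ¬ Y ≼ U → w Y ≈ 0#
    vanishes {Y} Y⋠U with Y ≼? S
    ... | no  Y⋠S = BasisSpan-vanishes (Gen⇒BasisSpan S w∈S) Y⋠S
    ... | yes Y≼S = BasisSpan-vanishes (Gen⇒BasisSpan T w∈T) (Y⋠U ∘ glb Y Y≼S)
    w≋ : ∀ {w′} → BasisSpan (_≼ U) w′ → (∀ {Y} → Y ≼ U → w Y ≈ w′ Y) → w ≋ w′
    w≋ w′∈U w≈w′ Y with Y ≼? U
    ... | yes Y≼U = w≈w′ Y≼U
    ... | no  Y⋠U = ≈-trans (vanishes Y⋠U) (≈-sym (BasisSpan-vanishes w′∈U Y⋠U))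

  Gen∩Gen⇔Gen-meet : ∀ S T U → IsMeet U S T → ∀ {w} → (Gen S w × Gen T w) ⇔ Gen U w
  Gen∩Gen⇔Gen-meet S T U meet@(U≼S , U≼T , _) = mk⇔
    (λ (w∈S , w∈T) → Gen∩Gen⇒Gen-meet S T U meet w∈S w∈T)
    (λ w∈U → Gen-mono S U U≼S w∈U , Gen-mono T U U≼T w∈U)

lemma4p1 : {c ℓ : Level} (F : CommutativeRing c ℓ) → IsField F → CharZero F →
    (n k : ℕ) → k ≤ n → (S T : Subset n) → ∣ S ∣ ≡ k → ∣ T ∣ ≡ k →
    let open Module F n in
    ((∀ w → Gen S w ⇔ BasisSpan (λ S′ → S′ ≼ S) w)
      × (∀ w → BasisSpan (λ U → ∣ U ∣ ≡ k) w ⇔ Gen (top n k) w))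
    × (((∀ w → Gen T w → Gen S w)) ⇔ (T ≼ S))
    × Σ (Subset n) (λ U → IsMeet U S T
        × (∀ w → (Gen S w × Gen T w) ⇔ Gen U w))
lemma4p1 F isField _ n k k≤n S T ∣S∣≡k ∣T∣≡k =
  ((λ _ → mk⇔ (Gen⇒BasisSpan S) (BasisSpan⇒Gen S)) , (λ _ → BasisSpan-∣∣≡⇔Gen-top k≤n))
  , Gen⊆Gen⇔≼ (IsField.1≉0 isField) S T
  , S ∧ T , meet , (λ _ → Gen∩Gen⇔Gen-meet S T (S ∧ T) meet)
  where
  open Linear F n
  meet : IsMeet (S ∧ T) S T
  meet = ∧-isMeet S T (trans ∣S∣≡k (sym ∣T∣≡k))
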